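{- For $n\ge 2$, $a_n(1;2\to 2)=a_n(2;1\to 1)=d_n+d_{n-1}$, where $d_m$ denotes the $m$-th derangement number.
   Context: Standard cycle form of $\sigma\in S_n$: $\sigma$ is written as a product of disjoint cycles (fixed points included as 1-cycles), each cycle written starting with its largest element, and the cycles listed in increasing order of their largest elements. The fundamental bijection $\theta:S_n\to S_n$ sends $\sigma$ to the permutation whose one-line notation is obtained by erasing the parentheses from the standard cycle form of $\sigma$ (e.g. $\sigma=413526987=(3)(5214)(6)(8)(97)$ gives $\theta(\sigma)=352146897$). For $\pi\in S_n$ write $\hat\pi=\theta^{ -1}(\pi)$. An arrow pattern $\alpha=(\nu;H)$ of size $k$ consists of a string $\nu=a_1\dots a_m$ of positive integers and a set $H=\{b_i\to c_i:1\le i\le h\}$ of arrows, such that the distinct integers appearing in $\nu$ or $H$ form exactly $[k]=\{1,\dots,k\}$. A permutation $\pi=\pi_1\cdots\pi_n\in S_n$ contains $\alpha$ if there is a set $X=\{x_1<\dots<x_k\}\subseteq[n]$ such that (i) there are positions $t_1<\dots<t_m$ with $\pi_{t_1}\cdots\pi_{t_m}=x_{a_1}\cdots x_{a_m}$, and (ii) $\hat\pi(x_{b_i})=x_{c_i}$ for every $i$; otherwise $\pi$ avoids $\alpha$. $a_n(\nu;H)$ is the number of $\pi\in S_n$ avoiding $(\nu;H)$. The derangement number $d_m$ is the number of fixed-point-free permutations of $[m]$ ($d_0=1$). -}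

module Defs where

open import Data.Nat using (ℕ; zero; suc; _+_; _∸_; _≡ᵇ_; _≤ᵇ_)
open import Data.Bool using (Bool; true; false; _∧_; _∨_; not; if_then_else_)
open import Data.List using (List; []; _∷_; map; concatMap; concat; length; _++_; upTo)
open import Data.Product using (_×_; _,_)

anyB : {A : Set} → (A → Bool) → List A → Bool
anyB p [] = false
anyB p (x ∷ xs) = p x ∨ anyB p xs

allB : {A : Set} → (A → Bool) → List A → Bool
allB p [] = true
allB p (x ∷ xs) = p x ∧ allB p xs

filterB : {A : Set} → (A → Bool) → List A → List A
filterB p [] = []
filterB p (x ∷ xs) = if p x then x ∷ filterB p xs else filterB p xs

countB : {A : Set} → (A → Bool) → List A → ℕ
countB p xs = length (filterB p xs)

elemB : ℕ → List ℕ → Bool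
elemB x ys = anyB (λ y → x ≡ᵇ y) ys

eqListB : List ℕ → List ℕ → Bool
eqListB [] [] = true
eqListB [] (_ ∷ _) = false
eqListB (_ ∷ _) [] = false
eqListB (x ∷ xs) (y ∷ ys) = (x ≡ᵇ y) ∧ eqListB xs ys

distinctB : List ℕ → Bool
distinctB [] = true
distinctB (x ∷ xs) = not (elemB x xs) ∧ distinctB xs

-- i-th entry (0-based), default 0
nth : List ℕ → ℕ → ℕ
nth [] _ = 0
nth (y ∷ ys) zero = y
nth (y ∷ ys) (suc i) = nth ys i

range : ℕ → List ℕ
range n = map suc (upTo n)

words : List ℕ → ℕ → List (List ℕ)
words A zero = [] ∷ []
words A (suc k) = concatMap (λ a → map (a ∷_) (words A k)) A

-- S_n : all permutations of [n], as one-line notations π₁ ⋯ πₙ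
S : ℕ → List (List ℕ)
S n = filterB distinctB (words (range n) n)

app : List ℕ → ℕ → ℕ
app σ x = nth σ (x ∸ 1)

cycleOf : List ℕ → ℕ → List ℕ
cycleOf σ x = x ∷ go (length σ) (app σ x)
  where
  go : ℕ → ℕ → List ℕ
  go zero _ = []
  go (suc f) y = if y ≡ᵇ x then [] else y ∷ go f (app σ y)

isCycleMax : List ℕ → ℕ → Bool
isCycleMax σ x = allB (λ y → y ≤ᵇ x) (cycleOf σ x)

-- standard cycle form: each cycle starts with its largest element,
-- cycles listed in increasing order of their largest elements
standardCycleForm : List ℕ → List (List ℕ)
standardCycleForm σ =
  map (cycleOf σ) (filterB (isCycleMax σ) (range (length σ)))

θ : List ℕ → List ℕ
θ σ = concat (standardCycleForm σ)

record ArrowPattern : Set where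
  constructor mkPattern
  field
    size   : ℕ
    word   : List ℕ
    arrows : List (ℕ × ℕ)

choose : List ℕ → ℕ → List (List ℕ)
choose xs zero = [] ∷ []
choose [] (suc k) = []
choose (x ∷ xs) (suc k) = map (x ∷_) (choose xs k) ++ choose xs (suc k)

isSubseq : List ℕ → List ℕ → Bool
isSubseq [] _ = true
isSubseq (_ ∷ _) [] = false
isSubseq (a ∷ as) (b ∷ bs) =
  if a ≡ᵇ b then isSubseq as bs else isSubseq (a ∷ as) bs

sel : List ℕ → ℕ → ℕ
sel X a = nth X (a ∸ 1)

-- π ∈ S_n contains α: there are σ = π̂ (i.e. θ σ = π, σ ∈ S_n) and
-- X = {x₁ < ⋯ < x_k} ⊆ [n] with x_{a₁} ⋯ x_{aₘ} a subsequence of π and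
-- σ(x_{bᵢ}) = x_{cᵢ} for all arrows.
contains : ℕ → List ℕ → ArrowPattern → Bool
contains n π (mkPattern k ν H) =
  anyB (λ σ → eqListB (θ σ) π ∧
         anyB (λ X → isSubseq (map (sel X) ν) π ∧
                     allB (λ { (b , c) → app σ (sel X b) ≡ᵇ sel X c }) H)
              (choose (range n) k))
       (S n)

a : ℕ → ArrowPattern → ℕ
a n α = countB (λ π → not (contains n π α)) (S n)

d : ℕ → ℕ
d m = countB (λ σ → allB (λ i → not (app σ i ≡ᵇ i)) (range m)) (S m)

pat1 : ArrowPattern
pat1 = mkPattern 2 (1 ∷ []) ((2 , 2) ∷ [])

pat2 : ArrowPattern
pat2 = mkPattern 2 (2 ∷ []) ((1 , 1) ∷ [])

{-# OPTIONS --safe #-}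
module Submission where

-- Write σ = π̂, so that π = θ σ. The cycles of σ start at their maxima and are
-- listed by increasing maxima, so the blocks of π start exactly at its
-- left-to-right maxima. Hence σ(x) can be read off π: it is the entry after x,
-- unless that entry is a new left-to-right maximum or x is last, in which case
-- it is the current left-to-right maximum. So θ is injective on S n, and a_n(ν;H)
-- counts the σ ∈ S n such that θ σ does not contain (ν;H).
--
-- For (1;2→2) and (2;1→1) the letter condition holds automatically, as every
-- x ∈ [n] occurs in π. So θ σ avoids the pattern iff σ has no fixed point other
-- than 1, resp. n. Such a σ is either a derangement of [n], or it fixes that
-- point and deleting it leaves a derangement of [n − 1].

open import Defs
open import Data.Bool using (Bool; true; false; T; T?; not; _∧_; _∨_; if_then_else_)
open import Data.Bool.Properties using (T-∧; T-∨)
open import Data.Nat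
  using (ℕ; zero; suc; pred; _+_; _∸_; _⊔_; _≤_; _<_; _≡ᵇ_; _≤ᵇ_; _<ᵇ_; z≤n; s≤s)
import Data.Nat
import Data.Nat.GeneralisedArithmetic as ℕ
open import Data.Nat.Properties
  using ( suc-injective; ≡ᵇ⇒≡; ≡⇒≡ᵇ; ≤ᵇ⇒≤; ≤⇒≤ᵇ; <ᵇ⇒<; <⇒<ᵇ; +-suc; +-comm; +-cancelˡ-≡
        ; ≤-refl; ≤-trans; ≤-antisym; ≤-pred; n≤1+n; n<1+n; <⇒≤; <-irrefl; <-asym; ≮⇒≥
        ; ≤-<-trans; <-≤-trans; ≤∧≢⇒<; 1+n≰n; n≢0⇒n>0; m≤n⇒m<n∨m≡n; m<n⇒0<n∸m; m∸n≤m
        ; m+[n∸m]≡n; m≤n⇒m⊔n≡n; m≥n⇒m⊔n≡m; module ≤-Reasoning )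
open import Data.List
  using ( List; []; _∷_; _++_; length; map; concat; concatMap; cartesianProductWith; take; drop
        ; filter; filterᵇ; applyUpTo; upTo )
open import Data.List.Properties
  using ( ∷-injective; length-map; length-++; length-upTo; length-applyUpTo; length-filter
        ; map-∘; map-id; map-id-local; map-cong-local; map-applyUpTo; take++drop≡id )
open import Data.List.Relation.Unary.Any using (Any; here; there)
import Data.List.Relation.Unary.Any as Any
open import Data.List.Relation.Unary.All as All using (All; []; _∷_)
import Data.List.Relation.Unary.All.Properties as All
open import Data.List.Relation.Unary.All.Properties.Core using (¬Any⇒All¬; All¬⇒¬Any)
open import Data.List.Relation.Unary.AllPairs using (AllPairs; []; _∷_)
import Data.List.Relation.Unary.AllPairs.Properties as AllPairs
open import Data.List.Relation.Unary.Unique.Propositional using (Unique)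
import Data.List.Relation.Unary.Unique.Propositional.Properties as Unique
open import Data.List.Relation.Binary.Disjoint.Propositional using (Disjoint)
open import Data.List.Relation.Binary.BagAndSetEquality using (∼bag⇒↭)
open import Data.List.Relation.Binary.Permutation.Propositional.Properties using (↭-length)
open import Data.List.Membership.Propositional using (_∈_; _∉_; find; lose)
open import Data.List.Membership.Propositional.Properties
  using ( ∈-map⁺; ∈-map⁻; ∈-filter⁺; ∈-filter⁻; ∈-upTo⁺; ∈-upTo⁻; ∈-applyUpTo⁺; ∈-applyUpTo⁻
        ; ∈-++⁺ˡ; ∈-++⁺ʳ; ∈-++⁻; ∈-concat⁺′; ∈-concat⁻′
        ; ∈-cartesianProductWith⁺; ∈-cartesianProductWith⁻ )
open import Data.List.Membership.Propositional.Properties.WithK using (unique∧set⇒bag)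
open import Data.List.Membership.DecPropositional Data.Nat._≟_ using (_∈?_)
open import Data.List.Extrema.Nat using (max; xs≤max; argmax-sel)
open import Data.Product using (∃-syntax; _×_; _,_; proj₁; proj₂)
open import Data.Sum using (_⊎_; inj₁; inj₂; [_,_])
open import Data.Unit using (⊤)
open import Function using (_∘_; _⇔_; mk⇔; Equivalence)
open import Relation.Binary.PropositionalEquality
  using (_≡_; _≢_; refl; sym; trans; cong; cong₂; subst; module ≡-Reasoning)
open import Relation.Nullary using (¬_; Dec; yes; no; contradiction)

T-not⁺ : ∀ {b} → ¬ T b → T (not b)
T-not⁺ {false} _ = _
T-not⁺ {true} ¬b = ¬b _

T-not⁻ : ∀ {b} → T (not b) → ¬ T b
T-not⁻ {false} _ ()

module _ {A : Set} (p : A → Bool) where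

  anyB⁺ : ∀ {xs} → Any (T ∘ p) xs → T (anyB p xs)
  anyB⁺ (here px) = Equivalence.from T-∨ (inj₁ px)
  anyB⁺ (there pxs) = Equivalence.from T-∨ (inj₂ (anyB⁺ pxs))

  anyB⁻ : ∀ xs → T (anyB p xs) → Any (T ∘ p) xs
  anyB⁻ (x ∷ xs) t with Equivalence.to T-∨ t
  ... | inj₁ px = here px
  ... | inj₂ pxs = there (anyB⁻ xs pxs)

  allB⁺ : ∀ {xs} → All (T ∘ p) xs → T (allB p xs)
  allB⁺ [] = _
  allB⁺ (px ∷ pxs) = Equivalence.from T-∧ (px , allB⁺ pxs)

  allB⁻ : ∀ xs → T (allB p xs) → All (T ∘ p) xs
  allB⁻ [] _ = []
  allB⁻ (x ∷ xs) t = let px , pxs = Equivalence.to T-∧ t in px ∷ allB⁻ xs pxs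

  filterB≡filterᵇ : ∀ xs → filterB p xs ≡ filterᵇ p xs
  filterB≡filterᵇ [] = refl
  filterB≡filterᵇ (x ∷ xs) with p x
  ... | true = cong (x ∷_) (filterB≡filterᵇ xs)
  ... | false = filterB≡filterᵇ xs

  ∈-filterB⁺ : ∀ {x xs} → x ∈ xs → T (p x) → x ∈ filterB p xs
  ∈-filterB⁺ {xs = xs} x∈ px = subst (_ ∈_) (sym (filterB≡filterᵇ xs)) (∈-filter⁺ (T? ∘ p) x∈ px)

  ∈-filterB⁻ : ∀ {x} xs → x ∈ filterB p xs → x ∈ xs × T (p x)
  ∈-filterB⁻ xs x∈ = ∈-filter⁻ (T? ∘ p) (subst (_ ∈_) (filterB≡filterᵇ xs) x∈)

  filterB-unique : ∀ {xs} → Unique xs → Unique (filterB p xs)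
  filterB-unique {xs} xs! = subst Unique (sym (filterB≡filterᵇ xs)) (Unique.filter⁺ (T? ∘ p) xs!)

  filterB-AllPairs : ∀ {R : A → A → Set} {xs} → AllPairs R xs → AllPairs R (filterB p xs)
  filterB-AllPairs {xs = xs} r = subst (AllPairs _) (sym (filterB≡filterᵇ xs)) (AllPairs.filter⁺ (T? ∘ p) r)

elemB⇔∈ : ∀ {x ys} → T (elemB x ys) ⇔ x ∈ ys
elemB⇔∈ {x} {ys} = mk⇔ (Any.map (≡ᵇ⇒≡ x _) ∘ anyB⁻ (x ≡ᵇ_) ys) (anyB⁺ (x ≡ᵇ_) ∘ Any.map (≡⇒≡ᵇ x _))

distinctB⇔Unique : ∀ {xs} → T (distinctB xs) ⇔ Unique xs
distinctB⇔Unique = mk⇔ to from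
  where
  to : ∀ {xs} → T (distinctB xs) → Unique xs
  to {[]} _ = []
  to {x ∷ xs} t = let x∉xs , xs! = Equivalence.to T-∧ t
                  in ¬Any⇒All¬ xs (T-not⁻ x∉xs ∘ Equivalence.from elemB⇔∈) ∷ to xs!
  from : ∀ {xs} → Unique xs → T (distinctB xs)
  from [] = _
  from (x∉xs ∷ xs!) = Equivalence.from T-∧ (T-not⁺ (All¬⇒¬Any x∉xs ∘ Equivalence.to elemB⇔∈) , from xs!)

eqListB⇔≡ : ∀ {xs ys} → T (eqListB xs ys) ⇔ xs ≡ ys
eqListB⇔≡ = mk⇔ to from
  where
  to : ∀ {xs ys} → T (eqListB xs ys) → xs ≡ ys
  to {[]} {[]} _ = refl
  to {x ∷ xs} {y ∷ ys} t = let x≡y , xs≡ys = Equivalence.to T-∧ t in cong₂ _∷_ (≡ᵇ⇒≡ x y x≡y) (to xs≡ys)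
  from : ∀ {xs ys} → xs ≡ ys → T (eqListB xs ys)
  from {[]} refl = _
  from {x ∷ xs} refl = Equivalence.from T-∧ (≡⇒≡ᵇ x x refl , from {xs} refl)

module _ {A : Set} where

  countB-cong : ∀ {p q : A → Bool} xs → (∀ {x} → x ∈ xs → T (p x) ⇔ T (q x)) → countB p xs ≡ countB q xs
  countB-cong [] _ = refl
  countB-cong {p} {q} (x ∷ xs) p⇔q with p x | q x | p⇔q (here refl)
  ... | true  | true  | _ = cong suc (countB-cong xs (p⇔q ∘ there))
  ... | false | false | _ = countB-cong xs (p⇔q ∘ there)
  ... | true  | false | e = contradiction (Equivalence.to e _) λ ()
  ... | false | true  | e = contradiction (Equivalence.from e _) λ ()

  countB-split : ∀ (p q : A → Bool) xs →
    countB p xs ≡ countB (λ x → p x ∧ not (q x)) xs + countB (λ x → p x ∧ q x) xs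
  countB-split p q [] = refl
  countB-split p q (x ∷ xs) with p x | q x
  ... | true  | true  = trans (cong suc (countB-split p q xs)) (sym (+-suc _ _))
  ... | true  | false = cong suc (countB-split p q xs)
  ... | false | _     = countB-split p q xs

  countB+countB-not : ∀ (p : A → Bool) xs → countB p xs + countB (not ∘ p) xs ≡ length xs
  countB+countB-not p [] = refl
  countB+countB-not p (x ∷ xs) with p x
  ... | true  = cong suc (countB+countB-not p xs)
  ... | false = trans (+-suc _ _) (cong suc (countB+countB-not p xs))

  unique∧set⇒length≡ : ∀ {xs ys : List A} → Unique xs → Unique ys →
    (∀ {x} → x ∈ xs → x ∈ ys) → (∀ {x} → x ∈ ys → x ∈ xs) → length xs ≡ length ys
  unique∧set⇒length≡ xs! ys! xs⊆ys ys⊆xs = ↭-length (∼bag⇒↭ (unique∧set⇒bag xs! ys! (mk⇔ xs⊆ys ys⊆xs)))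

unique∧⊆⇒length≤ : ∀ {xs ys : List ℕ} → Unique xs → Unique ys → (∀ {x} → x ∈ xs → x ∈ ys) → length xs ≤ length ys
unique∧⊆⇒length≤ {xs} {ys} xs! ys! xs⊆ys = begin
  length xs                   ≡⟨ unique∧set⇒length≡ xs! (Unique.filter⁺ (_∈? xs) ys!)
                                   (λ x∈ → ∈-filter⁺ (_∈? xs) (xs⊆ys x∈) x∈) (proj₂ ∘ ∈-filter⁻ (_∈? xs) {xs = ys}) ⟩
  length (filter (_∈? xs) ys) ≤⟨ length-filter (_∈? xs) ys ⟩
  length ys                   ∎
  where open ≤-Reasoning

module _ {A B : Set} where

  countB-bijection : ∀ (f : A → B) (g : B → A) {p : A → Bool} {q : B → Bool} {xs ys} →
    Unique xs → Unique ys →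
    (∀ {x} → x ∈ xs → T (p x) → f x ∈ ys × T (q (f x))) →
    (∀ {x} → x ∈ xs → T (p x) → g (f x) ≡ x) →
    (∀ {y} → y ∈ ys → T (q y) → ∃[ x ] x ∈ xs × T (p x) × f x ≡ y) →
    countB p xs ≡ countB q ys
  countB-bijection f g {p} {q} {xs} {ys} xs! ys! maps-to left-inverse onto = begin
    length P         ≡⟨ length-map f P ⟨
    length (map f P) ≡⟨ unique∧set⇒length≡ fP! (filterB-unique q ys!) fP⊆Q Q⊆fP ⟩
    length Q         ∎
    where
    open ≡-Reasoning
    P = filterB p xs
    Q = filterB q ys

    gfP≡P : map g (map f P) ≡ P
    gfP≡P = trans (sym (map-∘ P)) (map-id-local (All.tabulate λ x∈P →
      let x∈xs , px = ∈-filterB⁻ p xs x∈P in left-inverse x∈xs px))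

    fP! : Unique (map f P)
    fP! = Unique.map⁻ (subst Unique (sym gfP≡P) (filterB-unique p xs!))

    fP⊆Q : ∀ {y} → y ∈ map f P → y ∈ Q
    fP⊆Q y∈fP with ∈-map⁻ f y∈fP
    ... | x , x∈P , refl = let x∈xs , px = ∈-filterB⁻ p xs x∈P
                               fx∈ys , qfx = maps-to x∈xs px
                           in ∈-filterB⁺ q fx∈ys qfx

    Q⊆fP : ∀ {y} → y ∈ Q → y ∈ map f P
    Q⊆fP y∈Q with ∈-filterB⁻ q ys y∈Q
    ... | y∈ys , qy with onto y∈ys qy
    ... | x , x∈xs , px , refl = ∈-map⁺ f (∈-filterB⁺ p x∈xs px)

range-unique : ∀ n → Unique (range n)
range-unique n = Unique.map⁺ suc-injective (Unique.upTo⁺ n)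

range-sorted : ∀ n → AllPairs _<_ (range n)
range-sorted n = AllPairs.map⁺ (AllPairs.applyUpTo⁺₁ (λ i → i) n λ i<j _ → s≤s i<j)

length-range : ∀ n → length (range n) ≡ n
length-range n = trans (length-map suc (upTo n)) (length-upTo n)

∈-range⁺ : ∀ {n x} → 1 ≤ x → x ≤ n → x ∈ range n
∈-range⁺ {x = suc i} _ i<n = ∈-map⁺ suc (∈-upTo⁺ i<n)

∈-range⁻ : ∀ {n x} → x ∈ range n → 1 ≤ x × x ≤ n
∈-range⁻ x∈ with ∈-map⁻ suc x∈
... | i , i∈ , refl = s≤s z≤n , ∈-upTo⁻ i∈

∈-range-suc : ∀ {n x} → x ∈ range n → ∃[ i ] x ≡ suc i × i < n
∈-range-suc x∈ with ∈-map⁻ suc x∈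
... | i , i∈ , refl = i , refl , ∈-upTo⁻ i∈

nth-∈ : ∀ xs {i} → i < length xs → nth xs i ∈ xs
nth-∈ (x ∷ xs) {zero} _ = here refl
nth-∈ (x ∷ xs) {suc i} (s≤s i<) = there (nth-∈ xs i<)

nth-injective : ∀ {xs i j} → Unique xs → i < length xs → j < length xs → nth xs i ≡ nth xs j → i ≡ j
nth-injective {x ∷ xs} {zero} {zero} _ _ _ _ = refl
nth-injective {x ∷ xs} {zero} {suc j} (x∉ ∷ _) _ (s≤s j<) eq = contradiction eq (All.lookup x∉ (nth-∈ xs j<))
nth-injective {x ∷ xs} {suc i} {zero} (x∉ ∷ _) (s≤s i<) _ eq = contradiction (sym eq) (All.lookup x∉ (nth-∈ xs i<))
nth-injective {x ∷ xs} {suc i} {suc j} (_ ∷ xs!) (s≤s i<) (s≤s j<) eq = cong suc (nth-injective xs! i< j< eq)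

nth-map : ∀ (g : ℕ → ℕ) xs {i} → i < length xs → nth (map g xs) i ≡ g (nth xs i)
nth-map g (x ∷ xs) {zero} _ = refl
nth-map g (x ∷ xs) {suc i} (s≤s i<) = nth-map g xs i<

nth-++ˡ : ∀ xs ys {i} → i < length xs → nth (xs ++ ys) i ≡ nth xs i
nth-++ˡ (x ∷ xs) ys {zero} _ = refl
nth-++ˡ (x ∷ xs) ys {suc i} (s≤s i<) = nth-++ˡ xs ys i<

nth-++-length : ∀ xs y ys → nth (xs ++ y ∷ ys) (length xs) ≡ y
nth-++-length [] y ys = refl
nth-++-length (x ∷ xs) y ys = nth-++-length xs y ys

applyUpTo-nth : ∀ xs → applyUpTo (nth xs) (length xs) ≡ xs
applyUpTo-nth [] = refl
applyUpTo-nth (x ∷ xs) = cong (x ∷_) (applyUpTo-nth xs)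

map-app-range : ∀ σ → map (app σ) (range (length σ)) ≡ σ
map-app-range σ = trans (sym (map-∘ (upTo (length σ))))
  (trans (map-applyUpTo (λ i → i) (nth σ) (length σ)) (applyUpTo-nth σ))

take-length-++ : ∀ (xs ys : List ℕ) → take (length xs) (xs ++ ys) ≡ xs
take-length-++ [] ys = refl
take-length-++ (x ∷ xs) ys = cong (x ∷_) (take-length-++ xs ys)

drop-last : ∀ xs {k} → length xs ≡ suc k → drop k xs ≡ nth xs k ∷ []
drop-last (x ∷ []) {zero} _ = refl
drop-last (x ∷ y ∷ xs) {suc k} len = drop-last (y ∷ xs) (suc-injective len)

Unique[xs++ys]⇒Disjoint : ∀ {A : Set} (xs : List A) {ys} → Unique (xs ++ ys) → Disjoint xs ys
Unique[xs++ys]⇒Disjoint (_ ∷ xs) (x∉ ∷ _) (here refl , x∈ys) = All.lookup x∉ (∈-++⁺ʳ xs x∈ys) refl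
Unique[xs++ys]⇒Disjoint (_ ∷ xs) (_ ∷ xs!) (there x∈ , x∈ys) = Unique[xs++ys]⇒Disjoint xs xs! (x∈ , x∈ys)

concat-map-unique : ∀ {A B : Set} (g : A → List B) {xs} → Unique xs → (∀ {x} → x ∈ xs → Unique (g x)) →
  (∀ {x y z} → x ∈ xs → y ∈ xs → z ∈ g x → z ∈ g y → x ≡ y) → Unique (concat (map g xs))
concat-map-unique g xs! g! same = Unique.concat⁺ (All.map⁺ (All.tabulate g!)) (AllPairs.map⁺ (disjoint xs! same))
  where
  disjoint : ∀ {ys} → Unique ys → (∀ {x y z} → x ∈ ys → y ∈ ys → z ∈ g x → z ∈ g y → x ≡ y) →
    AllPairs (λ x y → Disjoint (g x) (g y)) ys
  disjoint [] _ = []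
  disjoint (x∉ ∷ ys!) same′ =
    All.tabulate (λ y∈ (z∈gx , z∈gy) → All.lookup x∉ y∈ (same′ (here refl) (there y∈) z∈gx z∈gy))
    ∷ disjoint ys! (λ x∈ y∈ → same′ (there x∈) (there y∈))

module _ {A B C : Set} (f : A → B → C) where

  concatMap≡cartesianProductWith : ∀ xs ys → concatMap (λ x → map (f x) ys) xs ≡ cartesianProductWith f xs ys
  concatMap≡cartesianProductWith [] ys = refl
  concatMap≡cartesianProductWith (x ∷ xs) ys = cong (map (f x) ys ++_) (concatMap≡cartesianProductWith xs ys)

∈-words⁺ : ∀ {A : List ℕ} k {w} → length w ≡ k → All (_∈ A) w → w ∈ words A k
∈-words⁺ zero {[]} _ [] = here refl
∈-words⁺ {A} (suc k) {a ∷ w} len (a∈A ∷ w⊆A) =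
  subst (_ ∈_) (sym (concatMap≡cartesianProductWith _∷_ A (words A k)))
    (∈-cartesianProductWith⁺ _∷_ a∈A (∈-words⁺ k (suc-injective len) w⊆A))

∈-words⁻ : ∀ (A : List ℕ) k {w} → w ∈ words A k → length w ≡ k × All (_∈ A) w
∈-words⁻ A zero (here refl) = refl , []
∈-words⁻ A (suc k) w∈
  with ∈-cartesianProductWith⁻ _∷_ A (words A k) (subst (_ ∈_) (concatMap≡cartesianProductWith _∷_ A (words A k)) w∈)
... | a , w , a∈A , w∈ , refl = let len , w⊆A = ∈-words⁻ A k w∈ in cong suc len , a∈A ∷ w⊆A

words-unique : ∀ {A : List ℕ} k → Unique A → Unique (words A k)
words-unique zero _ = [] ∷ []
words-unique {A} (suc k) A! = subst Unique (sym (concatMap≡cartesianProductWith _∷_ A (words A k)))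
  (Unique.cartesianProductWith⁺ _∷_ ∷-injective A! (words-unique k A!))

record IsPerm (n : ℕ) (σ : List ℕ) : Set where
  field
    length≡ : length σ ≡ n
    unique  : Unique σ
    ⊆range  : ∀ {x} → x ∈ σ → x ∈ range n

∈S⁺ : ∀ {n σ} → IsPerm n σ → σ ∈ S n
∈S⁺ {n} P = ∈-filterB⁺ distinctB (∈-words⁺ n length≡ (All.tabulate ⊆range)) (Equivalence.from distinctB⇔Unique unique)
  where open IsPerm P

∈S⁻ : ∀ n {σ} → σ ∈ S n → IsPerm n σ
∈S⁻ n σ∈ with ∈-filterB⁻ distinctB (words (range n) n) σ∈
... | σ∈words , σ! with ∈-words⁻ (range n) n σ∈words
... | len , σ⊆ = record { length≡ = len ; unique = Equivalence.to distinctB⇔Unique σ! ; ⊆range = All.lookup σ⊆ }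

S-unique : ∀ n → Unique (S n)
S-unique n = filterB-unique distinctB (words-unique n (range-unique n))

module _ {n σ} (P : IsPerm n σ) where
  open IsPerm P

  app-∈ : ∀ {x} → x ∈ range n → app σ x ∈ range n
  app-∈ x∈ with ∈-range-suc x∈
  ... | _ , refl , i<n = ⊆range (nth-∈ σ (subst (_ <_) (sym length≡) i<n))

  app-injective : ∀ {x y} → x ∈ range n → y ∈ range n → app σ x ≡ app σ y → x ≡ y
  app-injective x∈ y∈ eq with ∈-range-suc x∈ | ∈-range-suc y∈
  ... | _ , refl , i<n | _ , refl , j<n =
    cong suc (nth-injective unique (subst (_ <_) (sym length≡) i<n) (subst (_ <_) (sym length≡) j<n) eq)

fixes : List ℕ → ℕ → Bool
fixes σ x = app σ x ≡ᵇ x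

isDerangement : ℕ → List ℕ → Bool
isDerangement n σ = allB (λ x → not (fixes σ x)) (range n)

onlyFixedPoint : ℕ → ℕ → List ℕ → Bool
onlyFixedPoint j n σ = allB (λ x → (x ≡ᵇ j) ∨ not (fixes σ x)) (range n)

isDerangement⇔ : ∀ n σ → T (isDerangement n σ) ⇔ (∀ {x} → x ∈ range n → app σ x ≢ x)
isDerangement⇔ n σ = mk⇔ to from
  where
  to : T (isDerangement n σ) → ∀ {x} → x ∈ range n → app σ x ≢ x
  to t x∈ fx = T-not⁻ (All.lookup (allB⁻ _ (range n) t) x∈) (≡⇒≡ᵇ _ _ fx)
  from : (∀ {x} → x ∈ range n → app σ x ≢ x) → T (isDerangement n σ)
  from h = allB⁺ _ (All.tabulate λ x∈ → T-not⁺ (h x∈ ∘ ≡ᵇ⇒≡ _ _))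

onlyFixedPoint⇔ : ∀ j n σ → T (onlyFixedPoint j n σ) ⇔ (∀ {x} → x ∈ range n → app σ x ≡ x → x ≡ j)
onlyFixedPoint⇔ j n σ = mk⇔ to from
  where
  to : T (onlyFixedPoint j n σ) → ∀ {x} → x ∈ range n → app σ x ≡ x → x ≡ j
  to t {x} x∈ fx with Equivalence.to T-∨ (All.lookup (allB⁻ _ (range n) t) x∈)
  ... | inj₁ x≡j = ≡ᵇ⇒≡ x j x≡j
  ... | inj₂ x∉fix = contradiction (≡⇒≡ᵇ _ _ fx) (T-not⁻ x∉fix)
  from : (∀ {x} → x ∈ range n → app σ x ≡ x → x ≡ j) → T (onlyFixedPoint j n σ)
  from h = allB⁺ _ (All.tabulate λ {x} x∈ → Equivalence.from T-∨ (fixed-or-not x∈))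
    where
    fixed-or-not : ∀ {x} → x ∈ range n → T (x ≡ᵇ j) ⊎ T (not (fixes σ x))
    fixed-or-not {x} x∈ with app σ x Data.Nat.≟ x
    ... | yes fx = inj₁ (≡⇒≡ᵇ x j (h x∈ fx))
    ... | no ¬fx = inj₂ (T-not⁺ (¬fx ∘ ≡ᵇ⇒≡ _ _))

module _ {A : Set} (f : A → A) where

  iterate-+ : ∀ x i j → ℕ.iterate f x (i + j) ≡ ℕ.iterate f (ℕ.iterate f x i) j
  iterate-+ x zero j = refl
  iterate-+ x (suc i) j = iterate-+ (f x) i j

  iterate-suc : ∀ x i → ℕ.iterate f x (suc i) ≡ f (ℕ.iterate f x i)
  iterate-suc x zero = refl
  iterate-suc x (suc i) = iterate-suc (f x) i

headOr : ℕ → List ℕ → ℕ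
headOr M [] = M
headOr M (z ∷ _) = z

nextIn : ℕ → List ℕ → ℕ → ℕ
nextIn M [] x = 0
nextIn M (y ∷ ys) x = if y ≡ᵇ x then headOr M ys else nextIn M ys x

nextIn-orbit : ∀ (f : ℕ → ℕ) {M y} d x → ℕ.iterate f x d ≡ M →
  y ∈ applyUpTo (ℕ.iterate f x) d → nextIn M (applyUpTo (ℕ.iterate f x) d) y ≡ f y
nextIn-orbit f {y = y} (suc d) x ends y∈ with x ≡ᵇ y in x≟y
... | true with refl ← ≡ᵇ⇒≡ x _ (subst T (sym x≟y) _) = last d ends
  where
  last : ∀ d → ℕ.iterate f (f x) d ≡ _ → headOr _ (applyUpTo (ℕ.iterate f (f x)) d) ≡ f x
  last zero ends = sym ends
  last (suc d) _ = refl
... | false with y∈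
...   | here refl = contradiction (≡⇒≡ᵇ x x refl) (subst T x≟y)
...   | there y∈′ = nextIn-orbit f d (f x) ends y∈′

record CycleWalk (σ : List ℕ) (m : ℕ) : Set where
  field
    walk         : ℕ → ℕ → List ℕ
    walk-suc     : ∀ k y → walk (suc k) y ≡ (if y ≡ᵇ m then [] else y ∷ walk k (app σ y))
    cycleOf≡walk : cycleOf σ m ≡ m ∷ walk (length σ) (app σ m)

-- The local function go of cycleOf cannot be referred to by name, so it is
-- obtained by unification after abstracting its arguments.
cycleWalk : ∀ σ m → CycleWalk σ m
cycleWalk σ m = record { walk = walk ; walk-suc = λ _ _ → refl ; cycleOf≡walk = unfold }
  where
  walk : ℕ → ℕ → List ℕ
  walk = _
  unfold : cycleOf σ m ≡ m ∷ walk (length σ) (app σ m)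
  unfold with length σ | app σ m
  ... | _ | _ = refl

module Cycles {n σ} (P : IsPerm n σ) where
  open IsPerm P

  f : ℕ → ℕ
  f = app σ

  iterate-∈ : ∀ {x} k → x ∈ range n → ℕ.iterate f x k ∈ range n
  iterate-∈ zero x∈ = x∈
  iterate-∈ (suc k) x∈ = iterate-∈ k (app-∈ P x∈)

  iterate-cancel : ∀ {x} i k → x ∈ range n → ℕ.iterate f x i ≡ ℕ.iterate f x (i + k) → ℕ.iterate f x k ≡ x
  iterate-cancel zero k _ eq = sym eq
  iterate-cancel {x} (suc i) k x∈ eq =
    app-injective P (iterate-∈ k x∈) x∈ (trans (sym (iterate-suc f x k)) (iterate-cancel i k (app-∈ P x∈) eq))

  orbit-unique : ∀ {x} d → x ∈ range n → (∀ {k} → 0 < k → k < d → ℕ.iterate f x k ≢ x) →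
    Unique (applyUpTo (ℕ.iterate f x) d)
  orbit-unique {x} d x∈ no-return = Unique.applyUpTo⁺₁ (ℕ.iterate f x) d distinct
    where
    distinct : ∀ {i j} → i < j → j < d → ℕ.iterate f x i ≢ ℕ.iterate f x j
    distinct {i} {j} i<j j<d eq = no-return (m<n⇒0<n∸m i<j) (≤-<-trans (m∸n≤m j i) j<d)
      (iterate-cancel i (j ∸ i) x∈ (trans eq (cong (ℕ.iterate f x) (sym (m+[n∸m]≡n (<⇒≤ i<j))))))

  -- pigeonhole: x, f x, …, fⁿ x cannot be n + 1 distinct elements of [n]
  returns-within : ∀ {x} → x ∈ range n → ¬ (∀ {k} → 0 < k → k ≤ n → ℕ.iterate f x k ≢ x)
  returns-within {x} x∈ no-return = <-irrefl refl (begin-strict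
    n                                            <⟨ n<1+n n ⟩
    suc n                                        ≡⟨ length-applyUpTo (ℕ.iterate f x) (suc n) ⟨
    length (applyUpTo (ℕ.iterate f x) (suc n))   ≤⟨ unique∧⊆⇒length≤ orbit-unique′ (range-unique n) orbit⊆range ⟩
    length (range n)                             ≡⟨ length-range n ⟩
    n                                            ∎)
    where
    open ≤-Reasoning
    orbit-unique′ = orbit-unique (suc n) x∈ λ k>0 k<1+n → no-return k>0 (≤-pred k<1+n)
    orbit⊆range : ∀ {y} → y ∈ applyUpTo (ℕ.iterate f x) (suc n) → y ∈ range n
    orbit⊆range y∈ with ∈-applyUpTo⁻ (ℕ.iterate f x) y∈
    ... | k , _ , refl = iterate-∈ k x∈

  module _ (m : ℕ) where
    open CycleWalk (cycleWalk σ m)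

    walk-orbit : ∀ fuel y →
      (∃[ d ] walk fuel y ≡ applyUpTo (ℕ.iterate f y) d × ℕ.iterate f y d ≡ m × (∀ {i} → i < d → ℕ.iterate f y i ≢ m))
      ⊎ (∀ {i} → i < fuel → ℕ.iterate f y i ≢ m)
    walk-orbit zero y = inj₂ λ ()
    walk-orbit (suc k) y rewrite walk-suc k y with y ≡ᵇ m in y≟m
    ... | true = inj₁ (0 , refl , ≡ᵇ⇒≡ y m (subst T (sym y≟m) _) , λ ())
    ... | false with walk-orbit k (f y)
    ...   | inj₁ (d , walk≡ , ends , first) =
            inj₁ (suc d , cong (y ∷_) walk≡ , ends , λ { {zero} _ → y≢m ; {suc i} (s≤s i<d) → first i<d })
      where y≢m = subst T y≟m ∘ ≡⇒≡ᵇ y m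
    ...   | inj₂ never = inj₂ λ { {zero} _ → y≢m ; {suc i} (s≤s i<k) → never i<k }
      where y≢m = subst T y≟m ∘ ≡⇒≡ᵇ y m

  record Cycle (m : ℕ) : Set where
    field
      period        : ℕ
      cycleOf≡orbit : cycleOf σ m ≡ applyUpTo (ℕ.iterate f m) period
      returns       : ℕ.iterate f m period ≡ m
      first-return  : ∀ {k} → 0 < k → k < period → ℕ.iterate f m k ≢ m

  cycle : ∀ {m} → m ∈ range n → Cycle m
  cycle {m} m∈ with walk-orbit m n (f m)
  ... | inj₁ (d , walk≡ , ends , first) = record
    { period        = suc d
    ; cycleOf≡orbit = trans cycleOf≡walk (cong (m ∷_) (trans (cong (λ k → walk k (f m)) length≡) walk≡))
    ; returns       = ends
    ; first-return  = λ { {suc k} _ (s≤s k<d) → first k<d }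
    }
    where open CycleWalk (cycleWalk σ m)
  ... | inj₂ never = contradiction (λ { {suc k} _ k<n → never k<n }) (returns-within m∈)

  module _ {m} (m∈ : m ∈ range n) where
    open Cycle (cycle m∈)

    ∈-cycleOf⁻ : ∀ {y} → y ∈ cycleOf σ m → ∃[ i ] i < period × ℕ.iterate f m i ≡ y
    ∈-cycleOf⁻ {y} y∈ with ∈-applyUpTo⁻ (ℕ.iterate f m) (subst (y ∈_) cycleOf≡orbit y∈)
    ... | i , i<p , refl = i , i<p , refl

    cycleOf-closed : ∀ {y} → y ∈ cycleOf σ m → f y ∈ cycleOf σ m
    cycleOf-closed y∈ with ∈-cycleOf⁻ y∈
    ... | i , i<p , refl with m≤n⇒m<n∨m≡n i<p
    ...   | inj₁ i+1<p = subst (_ ∈_) (sym cycleOf≡orbit)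
                           (subst (_∈ _) (iterate-suc f m i) (∈-applyUpTo⁺ (ℕ.iterate f m) i+1<p))
    ...   | inj₂ i+1≡p = subst (_∈ _) m≡next (here refl)
      where
      m≡next : m ≡ f (ℕ.iterate f m i)
      m≡next = trans (sym returns) (trans (cong (ℕ.iterate f m) (sym i+1≡p)) (iterate-suc f m i))

    ∈-cycleOf⁺ : ∀ k → ℕ.iterate f m k ∈ cycleOf σ m
    ∈-cycleOf⁺ zero = here refl
    ∈-cycleOf⁺ (suc k) = subst (_∈ _) (sym (iterate-suc f m k)) (cycleOf-closed (∈-cycleOf⁺ k))

    cycleOf-unique : Unique (cycleOf σ m)
    cycleOf-unique = subst Unique (sym cycleOf≡orbit) (orbit-unique period m∈ first-return)

    nextIn-cycleOf : ∀ {y} → y ∈ cycleOf σ m → nextIn m (cycleOf σ m) y ≡ f y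
    nextIn-cycleOf {y} y∈ = subst (λ c → nextIn m c y ≡ f y) (sym cycleOf≡orbit)
      (nextIn-orbit f period m returns (subst (y ∈_) cycleOf≡orbit y∈))

    cycleOf-⊆range : ∀ {y} → y ∈ cycleOf σ m → y ∈ range n
    cycleOf-⊆range y∈ with ∈-cycleOf⁻ y∈
    ... | i , _ , refl = iterate-∈ i m∈

  cycleOf-trans : ∀ {x y z} → x ∈ range n → y ∈ cycleOf σ x → z ∈ cycleOf σ y → z ∈ cycleOf σ x
  cycleOf-trans x∈ y∈ z∈ with ∈-cycleOf⁻ x∈ y∈
  ... | i , _ , refl with ∈-cycleOf⁻ (cycleOf-⊆range x∈ y∈) z∈
  ...   | j , _ , refl = subst (_∈ _) (iterate-+ f _ i j) (∈-cycleOf⁺ x∈ (i + j))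

  cycleOf-sym : ∀ {x y} → x ∈ range n → y ∈ cycleOf σ x → x ∈ cycleOf σ y
  cycleOf-sym {x} x∈ y∈ with ∈-cycleOf⁻ x∈ y∈
  ... | i , i<p , refl = subst (_∈ _) back (∈-cycleOf⁺ (cycleOf-⊆range x∈ y∈) (period ∸ i))
    where
    open Cycle (cycle x∈)
    back : ℕ.iterate f (ℕ.iterate f x i) (period ∸ i) ≡ x
    back = trans (sym (iterate-+ f x i (period ∸ i))) (trans (cong (ℕ.iterate f x) (m+[n∸m]≡n (<⇒≤ i<p))) returns)

-- hat π is π̂: hatAt c π x is π̂(x), computed while reading π with c the
-- largest entry read so far.
closeAt : ℕ → List ℕ → ℕ
closeAt c [] = c
closeAt c (z ∷ _) = if z <ᵇ c then z else c

hatAt : ℕ → List ℕ → ℕ → ℕ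
hatAt c [] x = 0
hatAt c (y ∷ ys) x = if y ≡ᵇ x then closeAt (c ⊔ y) ys else hatAt (c ⊔ y) ys x

hat : List ℕ → List ℕ
hat π = map (hatAt 0 π) (range (length π))

HeadAbove : ℕ → List ℕ → Set
HeadAbove m [] = ⊤
HeadAbove m (z ∷ _) = m < z

module _ {m : ℕ} where

  closeAt-++ : ∀ {L} R → All (_≤ m) L → HeadAbove m R → closeAt m (L ++ R) ≡ headOr m L
  closeAt-++ [] [] _ = refl
  closeAt-++ (z ∷ R) [] m<z with z <ᵇ m in z<?m
  ... | true = contradiction (<ᵇ⇒< z m (subst T (sym z<?m) _)) (<-asym m<z)
  ... | false = refl
  closeAt-++ {z ∷ L} R (z≤m ∷ _) _ with z <ᵇ m in z<?m
  ... | true = refl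
  ... | false = ≤-antisym (≮⇒≥ (subst T z<?m ∘ <⇒<ᵇ)) z≤m

  hatAt-++-∈ : ∀ {L x} R → All (_≤ m) L → HeadAbove m R → x ∈ L → hatAt m (L ++ R) x ≡ nextIn m L x
  hatAt-++-∈ {y ∷ L} {x} R (y≤m ∷ L≤m) above x∈ rewrite m≥n⇒m⊔n≡m y≤m with y ≡ᵇ x in y≟x
  ... | true = closeAt-++ R L≤m above
  ... | false with x∈
  ...   | here refl = contradiction (≡⇒≡ᵇ y y refl) (subst T y≟x)
  ...   | there x∈L = hatAt-++-∈ R L≤m above x∈L

  hatAt-++-∉ : ∀ {L x} R → All (_≤ m) L → x ∉ L → hatAt m (L ++ R) x ≡ hatAt m R x
  hatAt-++-∉ {[]} R _ _ = refl
  hatAt-++-∉ {y ∷ L} {x} R (y≤m ∷ L≤m) x∉ rewrite m≥n⇒m⊔n≡m y≤m with y ≡ᵇ x in y≟x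
  ... | true = contradiction (here (sym (≡ᵇ⇒≡ y x (subst T (sym y≟x) _)))) x∉
  ... | false = hatAt-++-∉ R L≤m (x∉ ∘ there)

hatAt-new-max : ∀ {c m} L x → c ≤ m → hatAt c (m ∷ L) x ≡ hatAt m (m ∷ L) x
hatAt-new-max {c} {m} L x c≤m = cong (λ k → if m ≡ᵇ x then closeAt k L else hatAt k L x)
  (trans (m≤n⇒m⊔n≡n c≤m) (sym (m≥n⇒m⊔n≡m ≤-refl)))

module Theta {n σ} (P : IsPerm n σ) where
  open IsPerm P
  open Cycles P

  maxima : List ℕ
  maxima = filterB (isCycleMax σ) (range n)

  θ≡concat : θ σ ≡ concat (map (cycleOf σ) maxima)
  θ≡concat = cong (λ k → concat (map (cycleOf σ) (filterB (isCycleMax σ) (range k)))) length≡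

  isCycleMax⇔ : ∀ {m} → T (isCycleMax σ m) ⇔ All (_≤ m) (cycleOf σ m)
  isCycleMax⇔ {m} = mk⇔ (All.map (≤ᵇ⇒≤ _ m) ∘ allB⁻ (_≤ᵇ m) (cycleOf σ m)) (allB⁺ (_≤ᵇ m) ∘ All.map ≤⇒≤ᵇ)

  ∈-maxima⁻ : ∀ {m} → m ∈ maxima → m ∈ range n × All (_≤ m) (cycleOf σ m)
  ∈-maxima⁻ m∈ = let m∈range , max = ∈-filterB⁻ (isCycleMax σ) (range n) m∈ in m∈range , Equivalence.to isCycleMax⇔ max

  cycleOf-maximum : ∀ {x} → x ∈ range n → ∃[ m ] m ∈ maxima × x ∈ cycleOf σ m
  cycleOf-maximum {x} x∈ = M , ∈-filterB⁺ (isCycleMax σ) M∈range (Equivalence.from isCycleMax⇔ M-max) , cycleOf-sym x∈ M∈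
    where
    M = max x (cycleOf σ x)
    M∈ : M ∈ cycleOf σ x
    M∈ with argmax-sel (λ y → y) x (cycleOf σ x)
    ... | inj₁ M≡x = subst (_∈ cycleOf σ x) (sym M≡x) (here refl)
    ... | inj₂ M∈′ = M∈′
    M∈range = cycleOf-⊆range x∈ M∈
    M-max : All (_≤ M) (cycleOf σ M)
    M-max = All.tabulate λ y∈ → All.lookup (xs≤max x (cycleOf σ x)) (cycleOf-trans x∈ M∈ y∈)

  maxima-disjoint : ∀ {m m′ z} → m ∈ maxima → m′ ∈ maxima → z ∈ cycleOf σ m → z ∈ cycleOf σ m′ → m ≡ m′
  maxima-disjoint {m} {m′} m∈ m′∈ z∈ z∈′ = ≤-antisym (below m∈ m′∈ z∈ z∈′) (below m′∈ m∈ z∈′ z∈)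
    where
    below : ∀ {a b z} → a ∈ maxima → b ∈ maxima → z ∈ cycleOf σ a → z ∈ cycleOf σ b → a ≤ b
    below a∈ b∈ z∈a z∈b = let a∈range , _ = ∈-maxima⁻ a∈ ; b∈range , b-max = ∈-maxima⁻ b∈ in
      All.lookup b-max (cycleOf-trans b∈range z∈b (cycleOf-sym a∈range z∈a))

  θ-unique : Unique (θ σ)
  θ-unique = subst Unique (sym θ≡concat) (concat-map-unique (cycleOf σ)
    (filterB-unique (isCycleMax σ) (range-unique n)) (cycleOf-unique ∘ proj₁ ∘ ∈-maxima⁻) maxima-disjoint)

  θ-⊆range : ∀ {x} → x ∈ θ σ → x ∈ range n
  θ-⊆range {x} x∈ with ∈-concat⁻′ (map (cycleOf σ) maxima) (subst (x ∈_) θ≡concat x∈)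
  ... | c , x∈c , c∈ with ∈-map⁻ (cycleOf σ) c∈
  ...   | m , m∈ , refl = cycleOf-⊆range (proj₁ (∈-maxima⁻ m∈)) x∈c

  range⊆θ : ∀ {x} → x ∈ range n → x ∈ θ σ
  range⊆θ {x} x∈ with cycleOf-maximum x∈
  ... | m , m∈ , x∈c = subst (x ∈_) (sym θ≡concat) (∈-concat⁺′ x∈c (∈-map⁺ (cycleOf σ) m∈))

  θ-perm : IsPerm n (θ σ)
  θ-perm = record
    { length≡ = trans (unique∧set⇒length≡ θ-unique (range-unique n) θ-⊆range range⊆θ) (length-range n)
    ; unique  = θ-unique
    ; ⊆range  = θ-⊆range
    }

  hatAt-cycles : ∀ {c ms x} → AllPairs _<_ ms → All (c ≤_) ms → All (_∈ maxima) ms →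
    x ∈ concat (map (cycleOf σ) ms) → hatAt c (concat (map (cycleOf σ) ms)) x ≡ f x
  hatAt-cycles {c} {m ∷ ms} {x} (m<ms ∷ ms<) (c≤m ∷ _) (m∈ ∷ ms∈) x∈ =
    trans (hatAt-new-max (drop 1 (cycleOf σ m) ++ rest) x c≤m) (in-cycle (x ∈? cycleOf σ m))
    where
    rest = concat (map (cycleOf σ) ms)
    m∈range = proj₁ (∈-maxima⁻ m∈)
    m-max = proj₂ (∈-maxima⁻ m∈)

    above : ∀ ms → All (m <_) ms → HeadAbove m (concat (map (cycleOf σ) ms))
    above [] _ = _
    above (_ ∷ _) (m<m′ ∷ _) = m<m′

    in-cycle : Dec (x ∈ cycleOf σ m) → hatAt m (cycleOf σ m ++ rest) x ≡ f x
    in-cycle (yes x∈m) = trans (hatAt-++-∈ rest m-max (above ms m<ms) x∈m) (nextIn-cycleOf m∈range x∈m)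
    in-cycle (no x∉m) with ∈-++⁻ (cycleOf σ m) x∈
    ... | inj₁ x∈m = contradiction x∈m x∉m
    ... | inj₂ x∈rest = trans (hatAt-++-∉ rest m-max x∉m) (hatAt-cycles ms< (All.map <⇒≤ m<ms) ms∈ x∈rest)

  hat-θ : hat (θ σ) ≡ σ
  hat-θ = begin
    map (hatAt 0 (θ σ)) (range (length (θ σ))) ≡⟨ cong (λ k → map (hatAt 0 (θ σ)) (range k)) (IsPerm.length≡ θ-perm) ⟩
    map (hatAt 0 (θ σ)) (range n)              ≡⟨ map-cong-local (All.tabulate decode) ⟩
    map f (range n)                            ≡⟨ cong (λ k → map f (range k)) length≡ ⟨
    map f (range (length σ))                   ≡⟨ map-app-range σ ⟩
    σ                                          ∎
    where
    open ≡-Reasoning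
    decode : ∀ {x} → x ∈ range n → hatAt 0 (θ σ) x ≡ f x
    decode {x} x∈ = subst (λ π → hatAt 0 π x ≡ f x) (sym θ≡concat)
      (hatAt-cycles (filterB-AllPairs (isCycleMax σ) (range-sorted n)) (All.tabulate λ _ → z≤n) (All.tabulate λ m∈ → m∈)
        (subst (x ∈_) θ≡concat (range⊆θ x∈)))

-- The left-hand side is a n α for an arrow pattern α whose condition on π̂ and
-- π is occurs π̂ π.
avoiders-θ : ∀ n (occurs : List ℕ → List ℕ → Bool) →
  countB (λ π → not (anyB (λ σ → eqListB (θ σ) π ∧ occurs σ π) (S n))) (S n)
  ≡ countB (λ σ → not (occurs σ (θ σ))) (S n)
avoiders-θ n occurs = +-cancelˡ-≡ (countB contained (S n)) _ _ (begin
  countB contained (S n) + countB (not ∘ contained) (S n)   ≡⟨ countB+countB-not contained (S n) ⟩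
  length (S n)                                              ≡⟨ countB+countB-not occurs-θ (S n) ⟨
  countB occurs-θ (S n) + countB (not ∘ occurs-θ) (S n)     ≡⟨ cong (_+ countB (not ∘ occurs-θ) (S n)) occurs≡contained ⟩
  countB contained (S n) + countB (not ∘ occurs-θ) (S n)    ∎)
  where
  open ≡-Reasoning
  contained : List ℕ → Bool
  contained π = anyB (λ σ → eqListB (θ σ) π ∧ occurs σ π) (S n)
  occurs-θ : List ℕ → Bool
  occurs-θ σ = occurs σ (θ σ)

  occurs≡contained : countB occurs-θ (S n) ≡ countB contained (S n)
  occurs≡contained = countB-bijection θ hat {occurs-θ} {contained} (S-unique n) (S-unique n)
    (λ {σ} σ∈ occ → ∈S⁺ (Theta.θ-perm (∈S⁻ n σ∈)) ,
                    anyB⁺ _ (lose σ∈ (Equivalence.from T-∧ (Equivalence.from (eqListB⇔≡ {θ σ}) refl , occ))))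
    (λ σ∈ _ → Theta.hat-θ (∈S⁻ n σ∈))
    onto
    where
    onto : ∀ {π} → π ∈ S n → T (contained π) → ∃[ σ ] σ ∈ S n × T (occurs-θ σ) × θ σ ≡ π
    onto {π} _ c with find (anyB⁻ _ (S n) c)
    ... | σ , σ∈ , t with Equivalence.to T-∧ t
    ...   | θσ≡π , occ with refl ← Equivalence.to (eqListB⇔≡ {θ σ} {π}) θσ≡π = σ , σ∈ , occ , refl

choose-1 : ∀ (xs : List ℕ) → choose xs 1 ≡ map (_∷ []) xs
choose-1 [] = refl
choose-1 (x ∷ xs) = cong ((x ∷ []) ∷_) (choose-1 xs)

∈-choose-2⁻ : ∀ {xs X} → AllPairs _<_ xs → X ∈ choose xs 2 →
  ∃[ u ] ∃[ v ] X ≡ u ∷ v ∷ [] × u ∈ xs × v ∈ xs × u < v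
∈-choose-2⁻ {x ∷ xs} (x< ∷ xs<) X∈ with ∈-++⁻ (map (x ∷_) (choose xs 1)) X∈
... | inj₂ X∈′ = let u , v , X≡ , u∈ , v∈ , u<v = ∈-choose-2⁻ xs< X∈′ in u , v , X≡ , there u∈ , there v∈ , u<v
... | inj₁ X∈′ with ∈-map⁻ (x ∷_) X∈′
...   | Y , Y∈ , refl with ∈-map⁻ (_∷ []) (subst (Y ∈_) (choose-1 xs) Y∈)
...     | v , v∈ , refl = x , v , refl , here refl , there v∈ , All.lookup x< v∈

∈-choose-2⁺ : ∀ {xs u v} → AllPairs _<_ xs → u ∈ xs → v ∈ xs → u < v → u ∷ v ∷ [] ∈ choose xs 2
∈-choose-2⁺ {x ∷ xs} _ (here refl) (here refl) u<v = contradiction u<v (<-irrefl refl)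
∈-choose-2⁺ {x ∷ xs} _ (here refl) (there v∈) _ =
  ∈-++⁺ˡ (∈-map⁺ (x ∷_) (subst (_ ∈_) (sym (choose-1 xs)) (∈-map⁺ (_∷ []) v∈)))
∈-choose-2⁺ {x ∷ xs} (x< ∷ _) (there u∈) (here refl) u<v = contradiction (All.lookup x< u∈) (<-asym u<v)
∈-choose-2⁺ {x ∷ xs} (_ ∷ xs<) (there u∈) (there v∈) u<v = ∈-++⁺ʳ (map (x ∷_) (choose xs 1)) (∈-choose-2⁺ xs< u∈ v∈ u<v)

isSubseq-[_] : ∀ {a π} → a ∈ π → T (isSubseq (a ∷ []) π)
isSubseq-[_] {a} {b ∷ π} a∈ with a ≡ᵇ b in a≟b
... | true = _
... | false with a∈
...   | here refl = contradiction (≡⇒≡ᵇ a a refl) (subst T a≟b)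
...   | there a∈π = isSubseq-[ a∈π ]

-- The condition on X = {x₁ < x₂} for an occurrence of the pattern (a; b→b) of
-- size 2, as contains unfolds it.
letterAndLoopAt : ℕ → ℕ → List ℕ → List ℕ → List ℕ → Bool
letterAndLoopAt a b σ π X = isSubseq (sel X a ∷ []) π ∧ (fixes σ (sel X b) ∧ true)

letterAndLoop : ℕ → ℕ → ℕ → List ℕ → List ℕ → Bool
letterAndLoop a b n σ π = anyB (letterAndLoopAt a b σ π) (choose (range n) 2)

letterAndLoopAt⇔ : ∀ a b σ π X →
  T (letterAndLoopAt a b σ π X) ⇔ (T (isSubseq (sel X a ∷ []) π) × app σ (sel X b) ≡ sel X b)
letterAndLoopAt⇔ a b σ π X = mk⇔
  (λ t → let letter , loop = Equivalence.to (T-∧ {isSubseq (sel X a ∷ []) π}) t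
         in letter , ≡ᵇ⇒≡ _ _ (proj₁ (Equivalence.to (T-∧ {fixes σ (sel X b)}) loop)))
  (λ (letter , loop) → Equivalence.from (T-∧ {isSubseq (sel X a ∷ []) π})
    (letter , Equivalence.from (T-∧ {fixes σ (sel X b)}) (≡⇒≡ᵇ _ _ loop , _)))

letterAndLoop⇔ : ∀ a b {n σ π} → (∀ {u v} → u ∈ range n → v ∈ range n → sel (u ∷ v ∷ []) a ∈ π) →
  T (letterAndLoop a b n σ π) ⇔
  (∃[ u ] ∃[ v ] u ∈ range n × v ∈ range n × u < v × app σ (sel (u ∷ v ∷ []) b) ≡ sel (u ∷ v ∷ []) b)
letterAndLoop⇔ a b {n} {σ} {π} letter∈π = mk⇔ to from
  where
  to : T (letterAndLoop a b n σ π) → _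
  to occ with find (anyB⁻ (letterAndLoopAt a b σ π) (choose (range n) 2) occ)
  ... | X , X∈ , t with ∈-choose-2⁻ (range-sorted n) X∈
  ...   | u , v , refl , u∈ , v∈ , u<v = u , v , u∈ , v∈ , u<v , proj₂ (Equivalence.to (letterAndLoopAt⇔ a b σ π X) t)
  from : _ → T (letterAndLoop a b n σ π)
  from (u , v , u∈ , v∈ , u<v , loop) = anyB⁺ (letterAndLoopAt a b σ π)
    (lose (∈-choose-2⁺ (range-sorted n) u∈ v∈ u<v)
          (Equivalence.from (letterAndLoopAt⇔ a b σ π (u ∷ v ∷ [])) (isSubseq-[ letter∈π u∈ v∈ ] , loop)))

avoids-1-2⇔ : ∀ n σ π → (∀ {x} → x ∈ range n → x ∈ π) →
  T (not (letterAndLoop 1 2 n σ π)) ⇔ T (onlyFixedPoint 1 n σ)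
avoids-1-2⇔ n σ π range⊆π = mk⇔ to from
  where
  occurs⇔ = letterAndLoop⇔ 1 2 {n} {σ} {π} (λ u∈ _ → range⊆π u∈)

  to : T (not (letterAndLoop 1 2 n σ π)) → T (onlyFixedPoint 1 n σ)
  to avoid = Equivalence.from (onlyFixedPoint⇔ 1 n σ) only-1
    where
    only-1 : ∀ {x} → x ∈ range n → app σ x ≡ x → x ≡ 1
    only-1 {x} x∈ loop with m≤n⇒m<n∨m≡n (proj₁ (∈-range⁻ x∈))
    ... | inj₂ 1≡x = sym 1≡x
    ... | inj₁ 1<x = contradiction (Equivalence.from occurs⇔ (1 , x , 1∈ , x∈ , 1<x , loop)) (T-not⁻ avoid)
      where 1∈ = ∈-range⁺ ≤-refl (≤-trans (<⇒≤ 1<x) (proj₂ (∈-range⁻ x∈)))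

  from : T (onlyFixedPoint 1 n σ) → T (not (letterAndLoop 1 2 n σ π))
  from only = T-not⁺ λ occ →
    let u , v , u∈ , v∈ , u<v , loop = Equivalence.to occurs⇔ occ
    in <-irrefl (sym (Equivalence.to (onlyFixedPoint⇔ 1 n σ) only v∈ loop)) (≤-<-trans (proj₁ (∈-range⁻ u∈)) u<v)

avoids-2-1⇔ : ∀ n σ π → (∀ {x} → x ∈ range n → x ∈ π) →
  T (not (letterAndLoop 2 1 n σ π)) ⇔ T (onlyFixedPoint n n σ)
avoids-2-1⇔ n σ π range⊆π = mk⇔ to from
  where
  occurs⇔ = letterAndLoop⇔ 2 1 {n} {σ} {π} (λ _ v∈ → range⊆π v∈)

  to : T (not (letterAndLoop 2 1 n σ π)) → T (onlyFixedPoint n n σ)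
  to avoid = Equivalence.from (onlyFixedPoint⇔ n n σ) only-n
    where
    only-n : ∀ {x} → x ∈ range n → app σ x ≡ x → x ≡ n
    only-n {x} x∈ loop with m≤n⇒m<n∨m≡n (proj₂ (∈-range⁻ x∈))
    ... | inj₂ x≡n = x≡n
    ... | inj₁ x<n = contradiction (Equivalence.from occurs⇔ (x , n , x∈ , n∈ , x<n , loop)) (T-not⁻ avoid)
      where n∈ = ∈-range⁺ (≤-trans (proj₁ (∈-range⁻ x∈)) (proj₂ (∈-range⁻ x∈))) ≤-refl

  from : T (onlyFixedPoint n n σ) → T (not (letterAndLoop 2 1 n σ π))
  from only = T-not⁺ λ occ →
    let u , v , u∈ , v∈ , u<v , loop = Equivalence.to occurs⇔ occ
    in <-irrefl (Equivalence.to (onlyFixedPoint⇔ n n σ) only u∈ loop) (<-≤-trans u<v (proj₂ (∈-range⁻ v∈)))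

countB-onlyFixedPoint-split : ∀ {j n} → j ∈ range n →
  countB (onlyFixedPoint j n) (S n) ≡ d n + countB (λ σ → onlyFixedPoint j n σ ∧ fixes σ j) (S n)
countB-onlyFixedPoint-split {j} {n} j∈ = trans (countB-split (onlyFixedPoint j n) (λ σ → fixes σ j) (S n))
  (cong (_+ countB (λ σ → onlyFixedPoint j n σ ∧ fixes σ j) (S n))
    (countB-cong {q = isDerangement n} (S n) λ {σ} _ → mk⇔ (to σ) (from σ)))
  where
  to : ∀ σ → T (onlyFixedPoint j n σ ∧ not (fixes σ j)) → T (isDerangement n σ)
  to σ t = let only , j-moved = Equivalence.to (T-∧ {onlyFixedPoint j n σ}) t in
    Equivalence.from (isDerangement⇔ n σ) λ x∈ loop →
      T-not⁻ j-moved (≡⇒≡ᵇ _ _ (subst (λ y → app σ y ≡ y) (Equivalence.to (onlyFixedPoint⇔ j n σ) only x∈ loop) loop))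
  from : ∀ σ → T (isDerangement n σ) → T (onlyFixedPoint j n σ ∧ not (fixes σ j))
  from σ der = Equivalence.from T-∧
    ( Equivalence.from (onlyFixedPoint⇔ j n σ) (λ x∈ loop → contradiction loop (Equivalence.to (isDerangement⇔ n σ) der x∈))
    , T-not⁺ (Equivalence.to (isDerangement⇔ n σ) der j∈ ∘ ≡ᵇ⇒≡ _ _))

record FixedPointRemoval (j k : ℕ) : Set where
  field
    grow         : List ℕ → List ℕ
    shrink       : List ℕ → List ℕ
    shrink-grow  : ∀ {τ} → IsPerm k τ → shrink (grow τ) ≡ τ
    grow-shrink  : ∀ {σ} → IsPerm (suc k) σ → app σ j ≡ j → grow (shrink σ) ≡ σ
    grow-perm    : ∀ {τ} → IsPerm (suc k) (grow τ) ⇔ IsPerm k τ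
    grow-fixes   : ∀ {τ} → IsPerm k τ → app (grow τ) j ≡ j
    grow-only⇔   : ∀ {τ} → IsPerm k τ → T (onlyFixedPoint j (suc k) (grow τ)) ⇔ T (isDerangement k τ)

countB-fixing≡d : ∀ {j k} → FixedPointRemoval j k →
  countB (λ σ → onlyFixedPoint j (suc k) σ ∧ fixes σ j) (S (suc k)) ≡ d k
countB-fixing≡d {j} {k} R = countB-bijection shrink grow {q = isDerangement k} (S-unique (suc k)) (S-unique k)
  maps-to (λ {σ} σ∈ t → grow-shrink (∈S⁻ (suc k) σ∈) (loop {σ} t)) onto
  where
  open FixedPointRemoval R
  loop : ∀ {σ} → T (onlyFixedPoint j (suc k) σ ∧ fixes σ j) → app σ j ≡ j
  loop {σ} t = ≡ᵇ⇒≡ _ _ (proj₂ (Equivalence.to (T-∧ {onlyFixedPoint j (suc k) σ}) t))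

  maps-to : ∀ {σ} → σ ∈ S (suc k) → T (onlyFixedPoint j (suc k) σ ∧ fixes σ j) →
    shrink σ ∈ S k × T (isDerangement k (shrink σ))
  maps-to {σ} σ∈ t = ∈S⁺ shrunk , Equivalence.to (grow-only⇔ shrunk) (subst (T ∘ onlyFixedPoint j (suc k)) (sym σ≡) only)
    where
    σ≡ = grow-shrink (∈S⁻ (suc k) σ∈) (loop {σ} t)
    only = proj₁ (Equivalence.to (T-∧ {onlyFixedPoint j (suc k) σ}) t)
    shrunk = Equivalence.to grow-perm (subst (IsPerm (suc k)) (sym σ≡) (∈S⁻ (suc k) σ∈))

  onto : ∀ {τ} → τ ∈ S k → T (isDerangement k τ) →
    ∃[ σ ] σ ∈ S (suc k) × T (onlyFixedPoint j (suc k) σ ∧ fixes σ j) × shrink σ ≡ τ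
  onto {τ} τ∈ der = grow τ , ∈S⁺ (Equivalence.from grow-perm τ-perm) ,
    Equivalence.from T-∧ (Equivalence.from (grow-only⇔ τ-perm) der , ≡⇒≡ᵇ _ _ (grow-fixes τ-perm)) ,
    shrink-grow τ-perm
    where τ-perm = ∈S⁻ k τ∈

module RemoveFirst (k : ℕ) where

  grow : List ℕ → List ℕ
  grow τ = 1 ∷ map suc τ

  shrink : List ℕ → List ℕ
  shrink σ = map pred (drop 1 σ)

  shrink-grow : ∀ τ → shrink (grow τ) ≡ τ
  shrink-grow τ = trans (sym (map-∘ τ)) (map-id τ)

  grow-shrink : ∀ {σ} → IsPerm (suc k) σ → app σ 1 ≡ 1 → grow (shrink σ) ≡ σ
  grow-shrink {[]} _ ()
  grow-shrink {_ ∷ ρ} P refl = cong (1 ∷_) (trans (sym (map-∘ ρ)) (map-id-local (All.tabulate suc-pred)))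
    where
    suc-pred : ∀ {y} → y ∈ ρ → suc (pred y) ≡ y
    suc-pred y∈ with ∈-range-suc (IsPerm.⊆range P (there y∈))
    ... | _ , refl , _ = refl

  grow-perm : ∀ {τ} → IsPerm (suc k) (grow τ) ⇔ IsPerm k τ
  grow-perm {τ} = mk⇔ to from
    where
    to : IsPerm (suc k) (grow τ) → IsPerm k τ
    to P = record
      { length≡ = trans (sym (length-map suc τ)) (suc-injective length≡)
      ; unique  = Unique.map⁻ (Unique.drop⁺ 1 unique)
      ; ⊆range  = λ y∈ →
          ∈-range⁺ (n≢0⇒n>0 λ y≡0 → Unique.Unique[x∷xs]⇒x∉xs unique (subst (λ z → suc z ∈ _) y≡0 (∈-map⁺ suc y∈)))
                   (≤-pred (proj₂ (∈-range⁻ (⊆range (there (∈-map⁺ suc y∈))))))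
      }
      where open IsPerm P
    from : IsPerm k τ → IsPerm (suc k) (grow τ)
    from P = record
      { length≡ = cong suc (trans (length-map suc τ) length≡)
      ; unique  = All.map⁺ (All.tabulate λ y∈ 1≡1+y →
                    1+n≰n (subst (1 ≤_) (sym (suc-injective 1≡1+y)) (proj₁ (∈-range⁻ (⊆range y∈)))))
                  ∷ Unique.map⁺ suc-injective unique
      ; ⊆range  = λ { (here refl) → ∈-range⁺ ≤-refl (s≤s z≤n)
                   ; (there y∈) → shift (∈-map⁻ suc y∈) }
      }
      where
      open IsPerm P
      shift : ∀ {y} → ∃[ x ] x ∈ τ × y ≡ suc x → y ∈ range (suc k)
      shift (x , x∈ , refl) = ∈-range⁺ (s≤s z≤n) (s≤s (proj₂ (∈-range⁻ (⊆range x∈))))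

  app-grow : ∀ {τ x} → IsPerm k τ → x ∈ range k → app (grow τ) (suc x) ≡ suc (app τ x)
  app-grow {τ} P x∈ with ∈-range-suc x∈
  ... | i , refl , i<k = nth-map suc τ (subst (i <_) (sym (IsPerm.length≡ P)) i<k)

  grow-only⇔ : ∀ {τ} → IsPerm k τ → T (onlyFixedPoint 1 (suc k) (grow τ)) ⇔ T (isDerangement k τ)
  grow-only⇔ {τ} P = mk⇔ to from
    where
    to : T (onlyFixedPoint 1 (suc k) (grow τ)) → T (isDerangement k τ)
    to only = Equivalence.from (isDerangement⇔ k τ) λ x∈ loop →
      let suc-x≡1 = Equivalence.to (onlyFixedPoint⇔ 1 (suc k) (grow τ)) only
                      (∈-range⁺ (s≤s z≤n) (s≤s (proj₂ (∈-range⁻ x∈)))) (trans (app-grow P x∈) (cong suc loop))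
      in 1+n≰n (subst (1 ≤_) (suc-injective suc-x≡1) (proj₁ (∈-range⁻ x∈)))
    from : T (isDerangement k τ) → T (onlyFixedPoint 1 (suc k) (grow τ))
    from der = Equivalence.from (onlyFixedPoint⇔ 1 (suc k) (grow τ)) only-1
      where
      only-1 : ∀ {y} → y ∈ range (suc k) → app (grow τ) y ≡ y → y ≡ 1
      only-1 y∈ loop with ∈-range-suc y∈
      ... | zero , refl , _ = refl
      ... | suc i , refl , s≤s i<k = contradiction (suc-injective (trans (sym (app-grow P x∈)) loop))
                                                   (Equivalence.to (isDerangement⇔ k τ) der x∈)
        where x∈ = ∈-range⁺ (s≤s z≤n) i<k

  removal : FixedPointRemoval 1 k
  removal = record
    { grow = grow ; shrink = shrink ; shrink-grow = λ {τ} _ → shrink-grow τ ; grow-shrink = grow-shrink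
    ; grow-perm = grow-perm ; grow-fixes = λ _ → refl ; grow-only⇔ = grow-only⇔ }

module RemoveLast (k : ℕ) where

  grow : List ℕ → List ℕ
  grow τ = τ ++ suc k ∷ []

  length-grow : ∀ τ → length (grow τ) ≡ suc (length τ)
  length-grow τ = trans (length-++ τ) (+-comm (length τ) 1)

  shrink-grow : ∀ {τ} → IsPerm k τ → take k (grow τ) ≡ τ
  shrink-grow {τ} P = subst (λ l → take l (grow τ) ≡ τ) (IsPerm.length≡ P) (take-length-++ τ _)

  grow-shrink : ∀ {σ} → IsPerm (suc k) σ → app σ (suc k) ≡ suc k → grow (take k σ) ≡ σ
  grow-shrink {σ} P loop = begin
    take k σ ++ suc k ∷ []  ≡⟨ cong (λ y → take k σ ++ y ∷ []) loop ⟨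
    take k σ ++ nth σ k ∷ [] ≡⟨ cong (take k σ ++_) (drop-last σ (IsPerm.length≡ P)) ⟨
    take k σ ++ drop k σ    ≡⟨ take++drop≡id k σ ⟩
    σ                       ∎
    where open ≡-Reasoning

  grow-perm : ∀ {τ} → IsPerm (suc k) (grow τ) ⇔ IsPerm k τ
  grow-perm {τ} = mk⇔ to from
    where
    to : IsPerm (suc k) (grow τ) → IsPerm k τ
    to P = record
      { length≡ = suc-injective (trans (sym (length-grow τ)) length≡)
      ; unique  = subst Unique (take-length-++ τ _) (Unique.take⁺ (length τ) unique)
      ; ⊆range  = λ y∈ → let y∈range = ⊆range (∈-++⁺ˡ y∈) in
          ∈-range⁺ (proj₁ (∈-range⁻ y∈range))
            (≤-pred (≤∧≢⇒< (proj₂ (∈-range⁻ y∈range)) (λ { refl → Unique[xs++ys]⇒Disjoint τ unique (y∈ , here refl) })))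
      }
      where open IsPerm P
    from : IsPerm k τ → IsPerm (suc k) (grow τ)
    from P = record
      { length≡ = trans (length-grow τ) (cong suc length≡)
      ; unique  = Unique.++⁺ unique ([] ∷ []) λ { (y∈ , here refl) → 1+n≰n (proj₂ (∈-range⁻ (⊆range y∈))) }
      ; ⊆range  = λ y∈ → [ widen ∘ ⊆range , (λ { (here refl) → ∈-range⁺ (s≤s z≤n) ≤-refl }) ] (∈-++⁻ τ y∈)
      }
      where
      open IsPerm P
      widen : ∀ {y} → y ∈ range k → y ∈ range (suc k)
      widen y∈ = ∈-range⁺ (proj₁ (∈-range⁻ y∈)) (≤-trans (proj₂ (∈-range⁻ y∈)) (n≤1+n k))

  app-grow : ∀ {τ x} → IsPerm k τ → x ∈ range k → app (grow τ) x ≡ app τ x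
  app-grow {τ} P x∈ with ∈-range-suc x∈
  ... | i , refl , i<k = nth-++ˡ τ _ (subst (i <_) (sym (IsPerm.length≡ P)) i<k)

  grow-fixes : ∀ {τ} → IsPerm k τ → app (grow τ) (suc k) ≡ suc k
  grow-fixes {τ} P = subst (λ l → nth (grow τ) l ≡ suc k) (IsPerm.length≡ P) (nth-++-length τ (suc k) [])

  grow-only⇔ : ∀ {τ} → IsPerm k τ → T (onlyFixedPoint (suc k) (suc k) (grow τ)) ⇔ T (isDerangement k τ)
  grow-only⇔ {τ} P = mk⇔ to from
    where
    to : T (onlyFixedPoint (suc k) (suc k) (grow τ)) → T (isDerangement k τ)
    to only = Equivalence.from (isDerangement⇔ k τ) λ x∈ loop →
      let x≡1+k = Equivalence.to (onlyFixedPoint⇔ (suc k) (suc k) (grow τ)) only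
                    (∈-range⁺ (proj₁ (∈-range⁻ x∈)) (≤-trans (proj₂ (∈-range⁻ x∈)) (n≤1+n k))) (trans (app-grow P x∈) loop)
      in 1+n≰n (subst (_≤ k) x≡1+k (proj₂ (∈-range⁻ x∈)))
    from : T (isDerangement k τ) → T (onlyFixedPoint (suc k) (suc k) (grow τ))
    from der = Equivalence.from (onlyFixedPoint⇔ (suc k) (suc k) (grow τ)) only-last
      where
      only-last : ∀ {y} → y ∈ range (suc k) → app (grow τ) y ≡ y → y ≡ suc k
      only-last y∈ loop with m≤n⇒m<n∨m≡n (proj₂ (∈-range⁻ y∈))
      ... | inj₂ y≡1+k = y≡1+k
      ... | inj₁ y<1+k = contradiction (trans (sym (app-grow P y∈k)) loop) (Equivalence.to (isDerangement⇔ k τ) der y∈k)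
        where y∈k = ∈-range⁺ (proj₁ (∈-range⁻ y∈)) (≤-pred y<1+k)

  removal : FixedPointRemoval (suc k) k
  removal = record
    { grow = grow ; shrink = take k ; shrink-grow = shrink-grow ; grow-shrink = grow-shrink
    ; grow-perm = grow-perm ; grow-fixes = grow-fixes ; grow-only⇔ = grow-only⇔ }

a-letterAndLoop≡d+d : ∀ {ℓ b j k} → j ∈ range (suc k) →
  (∀ σ π → (∀ {x} → x ∈ range (suc k) → x ∈ π) →
     T (not (letterAndLoop ℓ b (suc k) σ π)) ⇔ T (onlyFixedPoint j (suc k) σ)) →
  FixedPointRemoval j k →
  a (suc k) (mkPattern 2 (ℓ ∷ []) ((b , b) ∷ [])) ≡ d (suc k) + d k
a-letterAndLoop≡d+d {ℓ} {b} {j} {k} j∈ avoids⇔ R = begin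
  a n (mkPattern 2 (ℓ ∷ []) ((b , b) ∷ []))                       ≡⟨ avoiders-θ n (letterAndLoop ℓ b n) ⟩
  countB (λ σ → not (letterAndLoop ℓ b n σ (θ σ))) (S n)           ≡⟨ countB-cong (S n) avoids-θ⇔ ⟩
  countB (onlyFixedPoint j n) (S n)                                ≡⟨ countB-onlyFixedPoint-split j∈ ⟩
  d n + countB (λ σ → onlyFixedPoint j n σ ∧ fixes σ j) (S n)      ≡⟨ cong (d n +_) (countB-fixing≡d R) ⟩
  d n + d k                                                        ∎
  where
  open ≡-Reasoning
  n = suc k
  avoids-θ⇔ : ∀ {σ} → σ ∈ S n → T (not (letterAndLoop ℓ b n σ (θ σ))) ⇔ T (onlyFixedPoint j n σ)
  avoids-θ⇔ {σ} σ∈ = avoids⇔ σ (θ σ) (Theta.range⊆θ (∈S⁻ n σ∈))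

-- The hypothesis 2 ≤ n only rules out n = 0; the proof works for every n ≥ 1.
theorem2p2 : (n : ℕ) → 2 ≤ n →
    (a n pat1 ≡ d n + d (n ∸ 1)) × (a n pat2 ≡ d n + d (n ∸ 1))
theorem2p2 (suc k) _ =
  a-letterAndLoop≡d+d {1} {2} (∈-range⁺ ≤-refl (s≤s z≤n)) (avoids-1-2⇔ (suc k)) (RemoveFirst.removal k) ,
  a-letterAndLoop≡d+d {2} {1} (∈-range⁺ (s≤s z≤n) ≤-refl) (avoids-2-1⇔ (suc k)) (RemoveLast.removal k)
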